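{- Let $G=(V,E)$ be an undirected graph on $n=|V|\ge 2$ vertices, and let $\vec{G}$ be an unknown acyclic orientation of $G$. Let $H$ be the complement graph of $G$ on $V$ (the graph of ``forbidden'' pairs), and let $\omega(H)$ be the clique number of $H$ (the size of a largest complete subgraph of $H$). Then there is a deterministic adaptive algorithm that, with access to the probe oracle, determines the orientation of every edge of $E$ (i.e. determines $\vec{G}$) using $O(n\,\omega(H)\log n)$ probes.
   Context: Probe model: for an edge $\{u,v\}\in E$, a probe of $(u,v)$ reveals whether the edge is oriented $u\to v$ or $v\to u$ in $\vec{G}$. Only pairs that are edges of $G$ may be probed. No Hamiltonian path in $\vec{G}$ is assumed. The probe count is the number of oracle calls made in the worst case. -}

module Defs where

open import Data.Nat using (ℕ; zero; suc; _≤_)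
open import Data.Bool using (Bool; true; false; not; if_then_else_)
open import Data.Fin using (Fin; zero; suc; fromℕ; inject₁; _≟_)
open import Data.Fin.Subset using (Subset; _∈_; ∣_∣)
open import Data.Product using (Σ; _×_; _,_)
open import Data.Unit using (⊤)
open import Data.Empty using (⊥-elim)
open import Relation.Nullary using (¬_; yes; no)
open import Relation.Binary.PropositionalEquality using (_≡_; _≢_; refl; sym; cong)

record Graph (n : ℕ) : Set where
  field
    adj    : Fin n → Fin n → Bool
    symm   : ∀ u v → adj u v ≡ adj v u
    irrefl : ∀ u → adj u u ≡ false
open Graph public

complement : ∀ {n} → Graph n → Graph n
complement {n} G = record { adj = a ; symm = s ; irrefl = i }
  where
  a : Fin n → Fin n → Bool
  a u v with u ≟ v
  ... | yes _ = false
  ... | no _  = not (adj G u v)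
  s : ∀ u v → a u v ≡ a v u
  s u v with u ≟ v | v ≟ u
  ... | yes _ | yes _ = refl
  ... | yes p | no q  = ⊥-elim (q (sym p))
  ... | no p  | yes q = ⊥-elim (p (sym q))
  ... | no _  | no _  = cong not (symm G u v)
  i : ∀ u → a u u ≡ false
  i u with u ≟ u
  ... | yes _ = refl
  ... | no p  = ⊥-elim (p refl)

IsClique : ∀ {n} → Graph n → Subset n → Set
IsClique K S = ∀ u v → u ∈ S → v ∈ S → u ≢ v → adj K u v ≡ true

IsCliqueNumber : ∀ {n} → Graph n → ℕ → Set
IsCliqueNumber {n} K w =
  (Σ (Subset n) λ S → IsClique K S × ∣ S ∣ ≡ w)
  × (∀ S → IsClique K S → ∣ S ∣ ≤ w)

-- An orientation is given by d : d u v ≡ true means the edge {u,v} is oriented u → v.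
Orient : ℕ → Set
Orient n = Fin n → Fin n → Bool

IsOrientation : ∀ {n} → Graph n → Orient n → Set
IsOrientation G d = ∀ u v → adj G u v ≡ true → d v u ≡ not (d u v)

Arc : ∀ {n} → Graph n → Orient n → Fin n → Fin n → Set
Arc G d u v = (adj G u v ≡ true) × (d u v ≡ true)

IsAcyclic : ∀ {n} → Graph n → Orient n → Set
IsAcyclic {n} G d = ∀ m (w : Fin (suc (suc m)) → Fin n) →
  w zero ≡ w (fromℕ (suc m)) →
  ¬ (∀ (i : Fin (suc m)) → Arc G d (w (inject₁ i)) (w (suc i)))

IsAcyclicOrientation : ∀ {n} → Graph n → Orient n → Set
IsAcyclicOrientation G d = IsOrientation G d × IsAcyclic G d

-- Deterministic adaptive probing algorithm = decision tree.
-- probe u v k : ask the oracle about pair (u,v); the answer is true iff u → v;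
-- continue with k answer.  done o : output the orientation o.
data Alg (n : ℕ) : Set where
  done  : Orient n → Alg n
  probe : Fin n → Fin n → (Bool → Alg n) → Alg n

output : ∀ {n} → Alg n → Orient n → Orient n
output (done o) d = o
output (probe u v k) d = output (k (d u v)) d

probes : ∀ {n} → Alg n → Orient n → ℕ
probes (done _) d = 0
probes (probe u v k) d = suc (probes (k (d u v)) d)

ValidRun : ∀ {n} → Graph n → Alg n → Orient n → Set
ValidRun G (done _) d = ⊤
ValidRun G (probe u v k) d = (adj G u v ≡ true) × ValidRun G (k (d u v)) d

CorrectRun : ∀ {n} → Graph n → Alg n → Orient n → Set
CorrectRun G A d = ∀ u v → adj G u v ≡ true → output A d u v ≡ d u v

-- Insert the vertices one at a time.  Before inserting x we know the orientation among the
-- earlier vertices and a relation R on them that lies inside reachability and contains every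
-- arc.  On the earlier neighbours of x, R is a partial order in which any two incomparable
-- elements are non-adjacent in G, so its antichains are cliques of H and its width is at most ω.
-- An answer y → x propagates to everything below y, and x → y to everything above y, so probing
-- a y with more than ⌊s/(2ω+1)⌋ of the s undecided neighbours below and above it decides that
-- many at once; by Mirsky's layer argument such a y exists.  Hence (2ω+1)(⌊log₂ n⌋+1) probes
-- settle the edges at x, after which R is extended by the pairs y ⇝ x ⇝ z.

module Submission where

open import Defs
open import Data.Bool using (Bool; true; false; not; _∧_; _∨_; if_then_else_)
open import Data.Bool.Properties using (¬-not; not-¬; ∧-zeroʳ; ∧-identityʳ) renaming (_≟_ to _≟ᵇ_)
open import Data.Fin using (Fin; zero; suc; toℕ; fromℕ; fromℕ<; inject₁; _≟_)
open import Data.Fin.Properties using (any?; suc-injective; toℕ-injective; toℕ-fromℕ<; toℕ<n)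
open import Data.Fin.Subset using (_∈_; ∣_∣; ⁅_⁆)
open import Data.Fin.Subset.Properties using (∣⁅x⁆∣≡1; x∈⁅y⁆⇒x≡y)
open import Data.Nat using (ℕ; zero; suc; _+_; _*_; _^_; _/_; _%_; _≤_; _<_; _≤?_; _<?_; z≤n; s≤s; z<s)
open import Data.Nat.DivMod using (m≡m%n+[m/n]*n; m%n<n; m/n*n≤m; /-monoˡ-≤)
open import Data.Nat.Logarithm using (⌊log₂_⌋; ⌊log₂⌋-mono-≤; ⌊log₂[2^n]⌋≡n)
open import Data.Nat.Properties hiding (_≟_; suc-injective)
open import Data.Nat.Tactic.RingSolver using (solve-∀)
open import Data.Product using (Σ; ∃; _×_; _,_; proj₁; proj₂)
open import Data.Sum using (_⊎_; inj₁; inj₂; [_,_]′)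
open import Data.Unit using (⊤; tt)
open import Data.Vec using (tabulate)
open import Data.Vec.Properties using (lookup∘tabulate; []=⇒lookup)
open import Function using (_∘_; flip; case_of_)
open import Relation.Binary.Construct.Closure.ReflexiveTransitive using (Star; ε; _◅_; _◅◅_)
open import Relation.Binary.PropositionalEquality
open import Relation.Nullary using (¬_; Dec; yes; no; does; contradiction)
open import Relation.Nullary.Decidable using (dec-true; dec-false)
open import Algebra.Properties.CommutativeSemigroup +-commutativeSemigroup using (interchange)

private
  variable
    n : ℕ
    X Y : Set

∧-true⁻ : ∀ {a b} → a ∧ b ≡ true → a ≡ true × b ≡ true
∧-true⁻ {true} {true} _ = refl , refl

∧-true⁺ : ∀ {a b} → a ≡ true → b ≡ true → a ∧ b ≡ true
∧-true⁺ refl refl = refl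

∨-true⁻ : ∀ {a b} → a ∨ b ≡ true → a ≡ true ⊎ b ≡ true
∨-true⁻ {true} _ = inj₁ refl
∨-true⁻ {false} e = inj₂ e

∨-true⁺ˡ : ∀ {a} b → a ≡ true → a ∨ b ≡ true
∨-true⁺ˡ b refl = refl

∨-true⁺ʳ : ∀ a {b} → b ≡ true → a ∨ b ≡ true
∨-true⁺ʳ true _ = refl
∨-true⁺ʳ false e = e

not-true⁻ : ∀ {a} → not a ≡ true → a ≡ false
not-true⁻ {false} _ = refl

does-true⁻ : ∀ {A : Set} (a? : Dec A) → does a? ≡ true → A
does-true⁻ (yes a) _ = a

does-false⁻ : ∀ {A : Set} (a? : Dec A) → does a? ≡ false → ¬ A
does-false⁻ (no ¬a) _ = ¬a

Predᵇ : ℕ → Set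
Predᵇ n = Fin n → Bool

Relᵇ : ℕ → Set
Relᵇ n = Fin n → Fin n → Bool

_⊆ᵇ_ : Predᵇ n → Predᵇ n → Set
P ⊆ᵇ Q = ∀ i → P i ≡ true → Q i ≡ true

search : (P : Predᵇ n) → Dec (∃ λ i → P i ≡ true)
search P = any? (λ i → P i ≟ᵇ true)

none⇒all-false : {P : Predᵇ n} → ¬ (∃ λ i → P i ≡ true) → ∀ i → P i ≡ false
none⇒all-false none i = ¬-not (λ e → none (i , e))

bit : Bool → ℕ
bit true = 1
bit false = 0

count : Predᵇ n → ℕ
count {zero} P = 0
count {suc n} P = bit (P zero) + count (P ∘ suc)

bit-mono : ∀ a b → (a ≡ true → b ≡ true) → bit a ≤ bit b
bit-mono false b _ = z≤n
bit-mono true b f rewrite f refl = ≤-refl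

count-mono : (P Q : Predᵇ n) → P ⊆ᵇ Q → count P ≤ count Q
count-mono {zero} P Q P⊆Q = z≤n
count-mono {suc n} P Q P⊆Q =
  +-mono-≤ (bit-mono (P zero) (Q zero) (P⊆Q zero)) (count-mono (P ∘ suc) (Q ∘ suc) (P⊆Q ∘ suc))

count-mono-< : (P Q : Predᵇ n) → P ⊆ᵇ Q → ∀ j → Q j ≡ true → P j ≡ false → count P < count Q
count-mono-< P Q P⊆Q zero Qj Pj rewrite Qj | Pj = s≤s (count-mono (P ∘ suc) (Q ∘ suc) (P⊆Q ∘ suc))
count-mono-< P Q P⊆Q (suc j) Qj Pj =
  ≤-trans (≤-reflexive (sym (+-suc (bit (P zero)) _)))
    (+-mono-≤ (bit-mono (P zero) (Q zero) (P⊆Q zero))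
              (count-mono-< (P ∘ suc) (Q ∘ suc) (P⊆Q ∘ suc) j Qj Pj))

count≤n : (P : Predᵇ n) → count P ≤ n
count≤n {zero} P = z≤n
count≤n {suc n} P with P zero
... | true = s≤s (count≤n (P ∘ suc))
... | false = m≤n⇒m≤1+n (count≤n (P ∘ suc))

count-none : (P : Predᵇ n) → (∀ i → P i ≡ false) → count P ≡ 0
count-none {zero} P none = refl
count-none {suc n} P none rewrite none zero = count-none (P ∘ suc) (none ∘ suc)

count-∨ : (P Q : Predᵇ n) → count (λ i → P i ∨ Q i) ≤ count P + count Q
count-∨ {zero} P Q = z≤n
count-∨ {suc n} P Q = begin
  bit (P zero ∨ Q zero) + count (λ i → P (suc i) ∨ Q (suc i))
    ≤⟨ +-mono-≤ (bit-∨ (P zero) (Q zero)) (count-∨ (P ∘ suc) (Q ∘ suc)) ⟩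
  (bit (P zero) + bit (Q zero)) + (count (P ∘ suc) + count (Q ∘ suc))
    ≡⟨ interchange (bit (P zero)) (bit (Q zero)) _ _ ⟩
  (bit (P zero) + count (P ∘ suc)) + (bit (Q zero) + count (Q ∘ suc)) ∎
  where
  open ≤-Reasoning
  bit-∨ : ∀ a b → bit (a ∨ b) ≤ bit a + bit b
  bit-∨ true b = s≤s z≤n
  bit-∨ false b = ≤-refl

count-split : (P Q : Predᵇ n) → count P ≡ count (λ i → P i ∧ Q i) + count (λ i → P i ∧ not (Q i))
count-split {zero} P Q = refl
count-split {suc n} P Q = begin
  bit (P zero) + count (P ∘ suc)
    ≡⟨ cong₂ _+_ (bit-split (P zero) (Q zero)) (count-split (P ∘ suc) (Q ∘ suc)) ⟩
  (bit (P zero ∧ Q zero) + bit (P zero ∧ not (Q zero)))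
    + (count (λ i → P (suc i) ∧ Q (suc i)) + count (λ i → P (suc i) ∧ not (Q (suc i))))
    ≡⟨ interchange (bit (P zero ∧ Q zero)) (bit (P zero ∧ not (Q zero))) _ _ ⟩
  count (λ i → P i ∧ Q i) + count (λ i → P i ∧ not (Q i)) ∎
  where
  open ≡-Reasoning
  bit-split : ∀ a b → bit a ≡ bit (a ∧ b) + bit (a ∧ not b)
  bit-split true true = refl
  bit-split true false = refl
  bit-split false b = refl

count-pos : (P : Predᵇ n) → ∀ j → P j ≡ true → 1 ≤ count P
count-pos P zero Pj rewrite Pj = s≤s z≤n
count-pos P (suc j) Pj = ≤-trans (count-pos (P ∘ suc) j Pj) (m≤n+m _ (bit (P zero)))

count-≥2 : (P : Predᵇ n) → ∀ a b → P a ≡ true → P b ≡ true → a ≢ b → 2 ≤ count P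
count-≥2 P a b Pa Pb a≢b =
  ≤-trans (s≤s (count-pos P∖a b (∧-true⁺ Pb (cong not (dec-false (b ≟ a) (a≢b ∘ sym))))))
    (count-mono-< P∖a P (λ i e → proj₁ (∧-true⁻ e)) a Pa P∖a-a)
  where
  P∖a : Predᵇ _
  P∖a i = P i ∧ not (does (i ≟ a))
  P∖a-a : P∖a a ≡ false
  P∖a-a rewrite dec-true (a ≟ a) refl = ∧-zeroʳ (P a)

count-unique : (P : Predᵇ n) (y : Fin n) → (∀ i → P i ≡ true → i ≡ y) → count P ≤ 1
count-unique P zero uniq
  rewrite count-none (P ∘ suc) (λ i → ¬-not (λ e → case uniq (suc i) e of λ ()))
        | +-identityʳ (bit (P zero)) = bit≤1 (P zero)
  where
  bit≤1 : ∀ a → bit a ≤ 1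
  bit≤1 true = ≤-refl
  bit≤1 false = z≤n
count-unique P (suc y) uniq rewrite ¬-not {P zero} {true} (λ e → case uniq zero e of λ ()) =
  count-unique (P ∘ suc) y (λ i e → suc-injective (uniq (suc i) e))

IsAntichain : Relᵇ n → Predᵇ n → Set
IsAntichain R P = ∀ a b → P a ≡ true → P b ≡ true → a ≢ b → R a b ≡ false

record IsPosetOfWidth (R : Relᵇ n) (T : Predᵇ n) (ω : ℕ) : Set where
  field
    reflexive     : ∀ a → T a ≡ true → R a a ≡ true
    transitive    : ∀ a b c → T a ≡ true → T b ≡ true → T c ≡ true →
                    R a b ≡ true → R b c ≡ true → R a c ≡ true
    antisymmetric : ∀ a b → T a ≡ true → T b ≡ true → R a b ≡ true → R b a ≡ true → a ≡ b
    width         : ∀ P → P ⊆ᵇ T → IsAntichain R P → count P ≤ ω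

dual : ∀ {R : Relᵇ n} {T ω} → IsPosetOfWidth R T ω → IsPosetOfWidth (flip R) T ω
dual po = record
  { reflexive     = reflexive
  ; transitive    = λ a b c Ta Tb Tc Rba Rcb → transitive c b a Tc Tb Ta Rcb Rba
  ; antisymmetric = λ a b Ta Tb Rba Rab → antisymmetric a b Ta Tb Rab Rba
  ; width         = λ P P⊆T anti → width P P⊆T (λ a b Pa Pb a≢b → anti b a Pb Pa (a≢b ∘ sym))
  }
  where open IsPosetOfWidth po

#below : Relᵇ n → Predᵇ n → Fin n → ℕ
#below R U y = count (λ z → U z ∧ R z y)

shallow : Relᵇ n → ℕ → Predᵇ n → Predᵇ n
shallow R j U y = U y ∧ does (#below R U y ≤? j)

balanced : Relᵇ n → ℕ → Predᵇ n → Predᵇ n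
balanced R j U y = U y ∧ does (j <? #below R U y) ∧ does (j <? #below (flip R) U y)

module PosetOfWidth {R : Relᵇ n} {T : Predᵇ n} {ω : ℕ} (po : IsPosetOfWidth R T ω) where
  open IsPosetOfWidth po

  #below-pos : ∀ {U} → U ⊆ᵇ T → ∀ y → U y ≡ true → 1 ≤ #below R U y
  #below-pos U⊆T y Uy = count-pos _ y (∧-true⁺ Uy (reflexive y (U⊆T y Uy)))

  #below-strict-mono : ∀ {U} → U ⊆ᵇ T → ∀ {y z} → U y ≡ true → U z ≡ true →
                       R z y ≡ true → z ≢ y → #below R U z < #below R U y
  #below-strict-mono {U} U⊆T {y} {z} Uy Uz Rzy z≢y =
    count-mono-< _ _ below-z⊆below-y y (∧-true⁺ Uy (reflexive y Ty)) y∉below-z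
    where
    Ty = U⊆T y Uy
    Tz = U⊆T z Uz
    below-z⊆below-y : (λ w → U w ∧ R w z) ⊆ᵇ (λ w → U w ∧ R w y)
    below-z⊆below-y w e = let (Uw , Rwz) = ∧-true⁻ e in
      ∧-true⁺ Uw (transitive w z y (U⊆T w Uw) Tz Ty Rwz Rzy)
    y∉below-z : U y ∧ R y z ≡ false
    y∉below-z = ¬-not λ e → z≢y (antisymmetric z y Tz Ty Rzy (proj₂ (∧-true⁻ e)))

  minimal-below : ∀ {U} → U ⊆ᵇ T → ∀ f y → #below R U y ≤ f → U y ≡ true →
                  ∃ λ m → shallow R 1 U m ≡ true × R m y ≡ true
  minimal-below U⊆T zero y ≤0 Uy = contradiction (≤-trans (#below-pos U⊆T y Uy) ≤0) λ ()
  minimal-below {U} U⊆T (suc f) y ≤f Uy with #below R U y ≤? 1 in e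
  ... | yes _ = y , ∧-true⁺ Uy (cong does e) , reflexive y (U⊆T y Uy)
  ... | no ≰1 with search (λ z → (U z ∧ R z y) ∧ not (does (z ≟ y)))
  ...   | no none = contradiction (count-unique _ y only-y) ≰1
    where
    only-y : ∀ z → U z ∧ R z y ≡ true → z ≡ y
    only-y z e with z ≟ y | none⇒all-false none z
    ... | yes z≡y | _ = z≡y
    ... | no _ | ≡false = contradiction (trans (sym (∧-true⁺ e refl)) ≡false) λ ()
  ...   | yes (z , e) =
    let (below , z≢y) = ∧-true⁻ e
        (Uz , Rzy) = ∧-true⁻ below
        z<y = #below-strict-mono U⊆T Uy Uz Rzy (does-false⁻ (z ≟ y) (not-true⁻ z≢y))
        (m , Mm , Rmz) = minimal-below U⊆T f z (≤-pred (≤-trans z<y ≤f)) Uz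
        Um = proj₁ (∧-true⁻ Mm)
    in m , Mm , transitive m z y (U⊆T m Um) (U⊆T z Uz) (U⊆T y Uy) Rmz Rzy

  minimal-antichain : ∀ {U} → U ⊆ᵇ T → IsAntichain R (shallow R 1 U)
  minimal-antichain {U} U⊆T a b Ma Mb a≢b = ¬-not λ Rab →
    let (Ua , _) = ∧-true⁻ Ma
        (Ub , b≤1) = ∧-true⁻ Mb
        a,b≤b = count-≥2 _ a b (∧-true⁺ Ua Rab) (∧-true⁺ Ub (reflexive b (U⊆T b Ub))) a≢b
    in <-irrefl refl (≤-trans a,b≤b (does-true⁻ (#below R U b ≤? 1) b≤1))

  -- The elements with #below ≤ 1 are the minimal ones, an antichain, and deleting them lowers
  -- #below of every remaining element.
  count-shallow : ∀ {U} → U ⊆ᵇ T → ∀ j → count (shallow R j U) ≤ j * ω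
  count-shallow {U} U⊆T zero = ≤-reflexive (count-none _ none)
    where
    none : ∀ y → shallow R 0 U y ≡ false
    none y = ¬-not λ e → let (Uy , ≤0) = ∧-true⁻ e in
      contradiction (≤-trans (#below-pos U⊆T y Uy) (does-true⁻ (#below R U y ≤? 0) ≤0)) λ ()
  count-shallow {U} U⊆T (suc j) = begin
    count (shallow R (suc j) U)                      ≤⟨ count-mono _ _ peel ⟩
    count (λ y → M y ∨ shallow R j U′ y)             ≤⟨ count-∨ M (shallow R j U′) ⟩
    count M + count (shallow R j U′)                 ≤⟨ +-mono-≤ |M|≤ω (count-shallow U′⊆T j) ⟩
    ω + j * ω                                        ∎
    where
    open ≤-Reasoning
    M = shallow R 1 U
    U′ : Predᵇ _
    U′ y = U y ∧ not (M y)
    U′⊆T : U′ ⊆ᵇ T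
    U′⊆T y e = U⊆T y (proj₁ (∧-true⁻ e))
    |M|≤ω : count M ≤ ω
    |M|≤ω = width M (λ y e → U⊆T y (proj₁ (∧-true⁻ e))) (minimal-antichain U⊆T)
    peel : shallow R (suc j) U ⊆ᵇ (λ y → M y ∨ shallow R j U′ y)
    peel y e with M y
    ... | true = refl
    ... | false =
      ∧-true⁺ (∧-true⁺ Uy refl) (dec-true (#below R U′ y ≤? j) (≤-pred (≤-trans fewer y≤1+j)))
      where
      Uy = proj₁ (∧-true⁻ e)
      y≤1+j = does-true⁻ (#below R U y ≤? suc j) (proj₂ (∧-true⁻ e))
      minimal = minimal-below U⊆T (#below R U y) y ≤-refl Uy
      m = proj₁ minimal
      Mm = proj₁ (proj₂ minimal)
      m∉U′ : U′ m ∧ R m y ≡ false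
      m∉U′ rewrite Mm | ∧-zeroʳ (U m) = refl
      fewer : #below R U′ y < #below R U y
      fewer = count-mono-< _ _
                (λ w e′ → let (U′w , Rwy) = ∧-true⁻ {U′ w} e′ in ∧-true⁺ (proj₁ (∧-true⁻ {U w} U′w)) Rwy)
                m (∧-true⁺ (proj₁ (∧-true⁻ Mm)) (proj₂ (proj₂ minimal))) m∉U′


exists-balanced : ∀ {R : Relᵇ n} {T ω} → IsPosetOfWidth R T ω →
                  ∀ {U} → U ⊆ᵇ T → ∀ j → j * (ω + ω) < count U →
                  ∃ λ y → balanced R j U y ≡ true
exists-balanced {R = R} {ω = ω} po {U} U⊆T j big with search (balanced R j U)
... | yes found = found
... | no none = contradiction big (≤⇒≯ (begin
  count U                                                 ≤⟨ count-mono _ _ cover ⟩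
  count (λ y → shallow R j U y ∨ shallow (flip R) j U y)  ≤⟨ count-∨ (shallow R j U) _ ⟩
  count (shallow R j U) + count (shallow (flip R) j U)
    ≤⟨ +-mono-≤ (PosetOfWidth.count-shallow po U⊆T j) (PosetOfWidth.count-shallow (dual po) U⊆T j) ⟩
  j * ω + j * ω                                           ≡⟨ *-distribˡ-+ j ω ω ⟨
  j * (ω + ω)                                             ∎))
  where
  open ≤-Reasoning
  cover : U ⊆ᵇ (λ y → shallow R j U y ∨ shallow (flip R) j U y)
  cover y Uy with j <? #below R U y in e₁ | j <? #below (flip R) U y in e₂
  ... | no j≮ | _ = ∨-true⁺ˡ _ (∧-true⁺ Uy (dec-true (#below R U y ≤? j) (≮⇒≥ j≮)))
  ... | yes _ | no j≮ = ∨-true⁺ʳ _ (∧-true⁺ Uy (dec-true (#below (flip R) U y ≤? j) (≮⇒≥ j≮)))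
  ... | yes _ | yes _ =
    contradiction (none⇒all-false none y) (not-¬ (∧-true⁺ Uy (∧-true⁺ (cong does e₁) (cong does e₂))))

data Probing (n : ℕ) (X : Set) : Set where
  return : X → Probing n X
  query  : Fin n → Fin n → (Bool → Probing n X) → Probing n X

_>>=_ : Probing n X → (X → Probing n Y) → Probing n Y
return x    >>= f = f x
query u v k >>= f = query u v (λ b → k b >>= f)

run : Probing n X → Orient n → X
run (return x)    d = x
run (query u v k) d = run (k (d u v)) d

cost : Probing n X → Orient n → ℕ
cost (return x)    d = 0
cost (query u v k) d = suc (cost (k (d u v)) d)

ProbesEdges : Graph n → Probing n X → Orient n → Set
ProbesEdges G (return x)    d = ⊤
ProbesEdges G (query u v k) d = adj G u v ≡ true × ProbesEdges G (k (d u v)) d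

run->>= : ∀ (m : Probing n X) (f : X → Probing n Y) d → run (m >>= f) d ≡ run (f (run m d)) d
run->>= (return x)    f d = refl
run->>= (query u v k) f d = run->>= (k (d u v)) f d

cost->>= : ∀ (m : Probing n X) (f : X → Probing n Y) d → cost (m >>= f) d ≡ cost m d + cost (f (run m d)) d
cost->>= (return x)    f d = refl
cost->>= (query u v k) f d = cong suc (cost->>= (k (d u v)) f d)

probesEdges->>= : ∀ G (m : Probing n X) (f : X → Probing n Y) d →
                  ProbesEdges G m d → ProbesEdges G (f (run m d)) d → ProbesEdges G (m >>= f) d
probesEdges->>= G (return x)    f d _          pf = pf
probesEdges->>= G (query u v k) f d (uv , pm) pf = uv , probesEdges->>= G (k (d u v)) f d pm pf

toAlg : Probing n (Orient n) → Alg n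
toAlg (return o)    = done o
toAlg (query u v k) = probe u v (toAlg ∘ k)

output-toAlg : ∀ (m : Probing n (Orient n)) d → output (toAlg m) d ≡ run m d
output-toAlg (return o)    d = refl
output-toAlg (query u v k) d = output-toAlg (k (d u v)) d

probes-toAlg : ∀ (m : Probing n (Orient n)) d → probes (toAlg m) d ≡ cost m d
probes-toAlg (return o)    d = refl
probes-toAlg (query u v k) d = cong suc (probes-toAlg (k (d u v)) d)

validRun-toAlg : ∀ G (m : Probing n (Orient n)) d → ProbesEdges G m d → ValidRun G (toAlg m) d
validRun-toAlg G (return o)    d _         = tt
validRun-toAlg G (query u v k) d (uv , p) = uv , validRun-toAlg G (k (d u v)) d p

Reach : Graph n → Orient n → Fin n → Fin n → Set
Reach G d = Star (Arc G d)

module _ {G : Graph n} {d : Orient n} where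

  private
    length : ∀ {y z} → Reach G d y z → ℕ
    length ε       = 0
    length (_ ◅ p) = suc (length p)

    vertex : ∀ {y z} (p : Reach G d y z) → Fin (suc (length p)) → Fin n
    vertex {y} ε       zero    = y
    vertex {y} (_ ◅ p) zero    = y
    vertex     (_ ◅ p) (suc i) = vertex p i

    vertex-first : ∀ {y z} (p : Reach G d y z) → vertex p zero ≡ y
    vertex-first ε       = refl
    vertex-first (_ ◅ p) = refl

    vertex-last : ∀ {y z} (p : Reach G d y z) → vertex p (fromℕ (length p)) ≡ z
    vertex-last ε       = refl
    vertex-last (_ ◅ p) = vertex-last p

    vertex-arc : ∀ {y z} (p : Reach G d y z) (i : Fin (length p)) →
                 Arc G d (vertex p (inject₁ i)) (vertex p (suc i))
    vertex-arc (a ◅ p) zero    = subst (Arc G d _) (sym (vertex-first p)) a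
    vertex-arc (_ ◅ p) (suc i) = vertex-arc p i

  arc-reach-acyclic : IsAcyclic G d → ∀ {u v} → Arc G d u v → ¬ Reach G d v u
  arc-reach-acyclic acyclic {u} a p = acyclic (length p) walk (sym (vertex-last p)) arcs
    where
    walk : Fin (suc (suc (length p))) → Fin n
    walk zero    = u
    walk (suc i) = vertex p i
    arcs : ∀ i → Arc G d (walk (inject₁ i)) (walk (suc i))
    arcs zero    = subst (Arc G d u) (sym (vertex-first p)) a
    arcs (suc i) = vertex-arc p i

  reach-antisym : IsAcyclic G d → ∀ {a b} → Reach G d a b → Reach G d b a → a ≡ b
  reach-antisym acyclic ε       _ = refl
  reach-antisym acyclic (a ◅ p) q = contradiction (p ◅◅ q) (arc-reach-acyclic acyclic a)

m<n*[1+m/n] : ∀ m w → m < suc w * suc (m / suc w)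
m<n*[1+m/n] m w = begin-strict
  m                                    ≡⟨ m≡m%n+[m/n]*n m (suc w) ⟩
  m % suc w + (m / suc w) * suc w      <⟨ +-monoˡ-< ((m / suc w) * suc w) (m%n<n m (suc w)) ⟩
  suc w + (m / suc w) * suc w          ≡⟨ *-comm (suc (m / suc w)) (suc w) ⟩
  suc w * suc (m / suc w)              ∎
  where open ≤-Reasoning

[m/[1+w]]*w<m : ∀ m w → 1 ≤ m → (m / suc w) * w < m
[m/[1+w]]*w<m m w 1≤m with m / suc w | m/n*n≤m m (suc w)
... | zero  | _       = 1≤m
... | suc q | q*1+w≤m = <-≤-trans (*-monoʳ-< (suc q) (n<1+n w)) q*1+w≤m

module Shrinking {S : Set} (size cost : S → ℕ) (w : ℕ)
  (stop : ∀ σ → size σ ≡ 0 → cost σ ≡ 0)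
  (step : ∀ σ → 1 ≤ size σ →
          ∃ λ σ′ → cost σ ≡ suc (cost σ′) × suc (size σ / suc w) + size σ′ ≤ size σ)
  where

  cost-bound : ∀ B σ → size σ < 2 ^ B → cost σ ≤ suc w * B
  cost-bound zero σ s<1 = ≤-reflexive (trans (stop σ (n<1⇒n≡0 s<1)) (sym (*-zeroʳ (suc w))))
  cost-bound (suc B) σ s<2h =
    ≤-trans (halve (suc w) 0 refl σ (subst (_< 2 * h) (sym (+-identityʳ (size σ))) s<2h))
            (≤-reflexive (sym (*-suc (suc w) B)))
    where
    h = 2 ^ B
    r = suc (h / suc w)
    -- While the size is at least h every step removes at least r > h / (1 + w) elements,
    -- so within 1 + w steps it drops below h.
    halve : ∀ m j → j + m ≡ suc w → ∀ σ → size σ + j * r < 2 * h → cost σ ≤ m + suc w * B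
    halve zero j j≡1+w σ lt =
      cost-bound B σ (+-cancelʳ-< (j * r) (size σ) h (<-trans lt′ (+-monoʳ-< h h<jr)))
      where
      lt′ : size σ + j * r < h + h
      lt′ = subst (size σ + j * r <_) (cong (h +_) (+-identityʳ h)) lt
      h<jr : h < j * r
      h<jr = subst (λ k → h < k * r) (sym (trans (sym (+-identityʳ j)) j≡1+w)) (m<n*[1+m/n] h w)
    halve (suc m) j j≡1+w σ lt with size σ <? h
    ... | yes s<h = ≤-trans (cost-bound B σ s<h) (m≤n+m _ (suc m))
    ... | no s≮h =
      let h≤s = ≮⇒≥ s≮h
          (σ′ , cost≡ , shrinks) = step σ (≤-trans (m^n>0 2 B) h≤s)
          r≤ : r ≤ suc (size σ / suc w)
          r≤ = s≤s (/-monoˡ-≤ (suc w) h≤s)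
          lt′ : size σ′ + suc j * r < 2 * h
          lt′ = begin-strict
            size σ′ + (r + j * r)                  ≡⟨ +-assoc (size σ′) r (j * r) ⟨
            (size σ′ + r) + j * r                  ≡⟨ cong (_+ j * r) (+-comm (size σ′) r) ⟩
            (r + size σ′) + j * r                  ≤⟨ +-monoˡ-≤ (j * r) (≤-trans (+-monoˡ-≤ (size σ′) r≤) shrinks) ⟩
            size σ + j * r                         <⟨ lt ⟩
            2 * h                                  ∎
      in ≤-trans (≤-reflexive cost≡) (s≤s (halve m (suc j) (trans (sym (+-suc j m)) j≡1+w) σ′ lt′))
      where open ≤-Reasoning

module Locate {n : ℕ} (R : Relᵇ n) (x : Fin n) (ω : ℕ) where

  -- The default y₀ is never used when U is nonempty: a balanced element then exists.
  choose : Predᵇ n → Fin n → Fin n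
  choose U y₀ with search (balanced R (count U / suc (ω + ω)) U)
  ... | yes (y , _) = y
  ... | no _        = y₀

  resolved : Fin n → Bool → Predᵇ n
  resolved y true  z = R z y
  resolved y false z = R y z

  remaining : Predᵇ n → Fin n → Bool → Predᵇ n
  remaining U y b z = U z ∧ not (resolved y b z)

  record-answer : Predᵇ n → Fin n → Bool → Predᵇ n
  record-answer g y b z = if resolved y b z then b else g z

  locate : ℕ → Predᵇ n → Predᵇ n → Probing n (Predᵇ n)
  locate zero    U g = return g
  locate (suc f) U g with search U
  ... | no _         = return g
  ... | yes (y₀ , _) = query y x λ b → locate f (remaining U y b) (record-answer g y b)
    where y = choose U y₀

module LocateCorrect {n : ℕ} {G : Graph n} {d : Orient n}
  (orientation : IsOrientation G d) (acyclic : IsAcyclic G d)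
  {R : Relᵇ n} {x : Fin n} {ω : ℕ} {T : Predᵇ n}
  (T⊆N[x] : ∀ y → T y ≡ true → adj G y x ≡ true)
  (po : IsPosetOfWidth R T ω)
  (sound : ∀ y z → T y ≡ true → T z ≡ true → R y z ≡ true → Reach G d y z)
  where

  open Locate R x ω
  open IsPosetOfWidth po

  arc-to-x : ∀ {z} → T z ≡ true → d z x ≡ true → Arc G d z x
  arc-to-x {z} Tz dzx = T⊆N[x] z Tz , dzx

  arc-from-x : ∀ {z} → T z ≡ true → d z x ≡ false → Arc G d x z
  arc-from-x {z} Tz dzx = trans (symm G x z) (T⊆N[x] z Tz) , trans (orientation z x (T⊆N[x] z Tz)) (cong not dzx)

  -- Otherwise x → z ⇝ y → x, respectively x → y ⇝ z → x, would be a cycle.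
  forced : ∀ y z → T y ≡ true → T z ≡ true → resolved y (d y x) z ≡ true → d z x ≡ d y x
  forced y z Ty Tz res with d y x in dyx | d z x in dzx
  ... | true  | true  = refl
  ... | false | false = refl
  ... | true  | false =
    contradiction (sound z y Tz Ty res ◅◅ (arc-to-x Ty dyx ◅ ε))
                  (arc-reach-acyclic {G = G} acyclic (arc-from-x Tz dzx))
  ... | false | true  =
    contradiction (sound y z Ty Tz res ◅◅ (arc-to-x Tz dzx ◅ ε))
                  (arc-reach-acyclic {G = G} acyclic (arc-from-x Ty dyx))

  Located : Predᵇ n → Predᵇ n → Set
  Located U g = ∀ z → T z ≡ true → U z ≡ false → g z ≡ d z x

  located-step : ∀ {U g} y → U ⊆ᵇ T → U y ≡ true → Located U g →
                 Located (remaining U y (d y x)) (record-answer g y (d y x))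
  located-step {U} y U⊆T Uy loc z Tz U′z with resolved y (d y x) z in res
  ... | true  = sym (forced y z (U⊆T y Uy) Tz res)
  ... | false = loc z Tz (trans (sym (∧-identityʳ (U z))) U′z)

  remaining-⊆ : ∀ U y b → remaining U y b ⊆ᵇ U
  remaining-⊆ U y b z e = proj₁ (∧-true⁻ {U z} e)

  remaining-< : ∀ {U} y b → U ⊆ᵇ T → U y ≡ true → count (remaining U y b) < count U
  remaining-< {U} y b U⊆T Uy = count-mono-< _ U (remaining-⊆ U y b) y Uy (y∉ b)
    where
    y∉ : ∀ b → remaining U y b y ≡ false
    y∉ true  rewrite Uy | reflexive y (U⊆T y Uy) = refl
    y∉ false rewrite Uy | reflexive y (U⊆T y Uy) = refl

  choose-∈ : ∀ U y₀ → U y₀ ≡ true → U (choose U y₀) ≡ true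
  choose-∈ U y₀ Uy₀ with search (balanced R (count U / suc (ω + ω)) U)
  ... | yes (y , e) = proj₁ (∧-true⁻ e)
  ... | no _        = Uy₀

  locate-correct : ∀ f U g → U ⊆ᵇ T → count U ≤ f → Located U g →
                   ∀ z → T z ≡ true → run (locate f U g) d z ≡ d z x
  locate-correct zero U g _ ≤0 loc z Tz =
    loc z Tz (¬-not λ Uz → contradiction (≤-trans (count-pos U z Uz) ≤0) λ ())
  locate-correct (suc f) U g U⊆T ≤f loc z Tz with search U
  ... | no none = loc z Tz (none⇒all-false none z)
  ... | yes (y₀ , Uy₀) =
    locate-correct f (remaining U y (d y x)) (record-answer g y (d y x))
      (λ z e → U⊆T z (remaining-⊆ U y (d y x) z e))
      (≤-pred (≤-trans (remaining-< y (d y x) U⊆T Uy) ≤f))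
      (located-step y U⊆T Uy loc) z Tz
    where
    y = choose U y₀
    Uy = choose-∈ U y₀ Uy₀

  locate-probesEdges : ∀ f U g → U ⊆ᵇ T → ProbesEdges G (locate f U g) d
  locate-probesEdges zero U g U⊆T = tt
  locate-probesEdges (suc f) U g U⊆T with search U
  ... | no _ = tt
  ... | yes (y₀ , Uy₀) =
    T⊆N[x] y (U⊆T y Uy) ,
    locate-probesEdges f (remaining U y (d y x)) (record-answer g y (d y x))
      (λ z e → U⊆T z (remaining-⊆ U y (d y x) z e))
    where
    y = choose U y₀
    Uy = choose-∈ U y₀ Uy₀

  choose-balanced : ∀ U y₀ → ∃ (λ y → balanced R (count U / suc (ω + ω)) U y ≡ true) →
                    balanced R (count U / suc (ω + ω)) U (choose U y₀) ≡ true
  choose-balanced U y₀ (y , e) with search (balanced R (count U / suc (ω + ω)) U)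
  ... | yes (_ , e′) = e′
  ... | no none      = contradiction (none⇒all-false none y) (not-¬ e)

  record State : Set where
    constructor state
    field
      fuel        : ℕ
      unresolved  : Predᵇ n
      answers     : Predᵇ n
      unresolved⊆T : unresolved ⊆ᵇ T
      fits        : count unresolved ≤ fuel

  size : State → ℕ
  size σ = count (State.unresolved σ)

  probesLeft : State → ℕ
  probesLeft (state f U g _ _) = cost (locate f U g) d

  probesLeft-empty : ∀ σ → size σ ≡ 0 → probesLeft σ ≡ 0
  probesLeft-empty (state zero U g _ _) _ = refl
  probesLeft-empty (state (suc f) U g _ _) ≡0 with search U
  ... | no _           = refl
  ... | yes (y₀ , Uy₀) = contradiction (subst (1 ≤_) ≡0 (count-pos U y₀ Uy₀)) λ ()

  probe-shrinks : ∀ σ → 1 ≤ size σ →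
    ∃ λ σ′ → probesLeft σ ≡ suc (probesLeft σ′) × suc (size σ / suc (ω + ω)) + size σ′ ≤ size σ
  probe-shrinks (state zero U g _ fits) 1≤ = contradiction (≤-trans 1≤ fits) λ ()
  probe-shrinks (state (suc f) U g U⊆T fits) 1≤ with search U
  ... | no none = contradiction (subst (1 ≤_) (count-none U (none⇒all-false none)) 1≤) λ ()
  ... | yes (y₀ , Uy₀) =
    state f (remaining U y b) (record-answer g y b) (λ z e → U⊆T z (remaining-⊆ U y b z e))
          (≤-pred (≤-trans (remaining-< y b U⊆T Uy) fits)) ,
    refl , removes
    where
    open ≤-Reasoning
    j = count U / suc (ω + ω)
    y = choose U y₀
    b = d y x
    Uy = choose-∈ U y₀ Uy₀
    bal : balanced R j U y ≡ true
    bal = choose-balanced U y₀ (exists-balanced po U⊆T j ([m/[1+w]]*w<m (count U) (ω + ω) 1≤))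
    many-resolved : ∀ b → j < count (λ z → U z ∧ resolved y b z)
    many-resolved true  = does-true⁻ (j <? _) (proj₁ (∧-true⁻ (proj₂ (∧-true⁻ {U y} bal))))
    many-resolved false = does-true⁻ (j <? _) (proj₂ (∧-true⁻ (proj₂ (∧-true⁻ {U y} bal))))
    removes : suc j + count (remaining U y b) ≤ count U
    removes = begin
      suc j + count (remaining U y b)
        ≤⟨ +-monoˡ-≤ _ (many-resolved b) ⟩
      count (λ z → U z ∧ resolved y b z) + count (remaining U y b)
        ≡⟨ count-split U (resolved y b) ⟨
      count U ∎

  locate-cost : ∀ B f U g → U ⊆ᵇ T → count U ≤ f → count U < 2 ^ B →
                cost (locate f U g) d ≤ suc (ω + ω) * B
  locate-cost B f U g U⊆T fits =
    Shrinking.cost-bound size probesLeft (ω + ω) probesLeft-empty probe-shrinks B (state f U g U⊆T fits)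

IsIndependent : Graph n → Predᵇ n → Set
IsIndependent G P = ∀ u v → P u ≡ true → P v ≡ true → u ≢ v → adj G u v ≡ false

∣tabulate∣≡count : (P : Predᵇ n) → ∣ tabulate P ∣ ≡ count P
∣tabulate∣≡count {zero} P = refl
∣tabulate∣≡count {suc n} P with P zero
... | true  = cong suc (∣tabulate∣≡count (P ∘ suc))
... | false = ∣tabulate∣≡count (P ∘ suc)

∈tabulate⁻ : (P : Predᵇ n) → ∀ {u} → u ∈ tabulate P → P u ≡ true
∈tabulate⁻ P {u} u∈ = trans (sym (lookup∘tabulate P u)) ([]=⇒lookup u∈)

complement-adj : (G : Graph n) → ∀ {u v} → u ≢ v → adj G u v ≡ false → adj (complement G) u v ≡ true
complement-adj G {u} {v} u≢v uv with u ≟ v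
... | yes u≡v = contradiction u≡v u≢v
... | no _    = cong not uv

independent≤clique-number : ∀ (G : Graph n) {ω} → IsCliqueNumber (complement G) ω →
                            ∀ P → IsIndependent G P → count P ≤ ω
independent≤clique-number G (_ , maximum) P independent =
  subst (_≤ _) (∣tabulate∣≡count P) (maximum (tabulate P) clique)
  where
  clique : IsClique (complement G) (tabulate P)
  clique u v u∈ v∈ u≢v =
    complement-adj G u≢v (independent u v (∈tabulate⁻ P u∈) (∈tabulate⁻ P v∈) u≢v)

clique-number-pos : (K : Graph (suc n)) → ∀ {ω} → IsCliqueNumber K ω → 1 ≤ ω
clique-number-pos {n} K {ω} (_ , maximum) =
  subst (_≤ ω) (∣⁅x⁆∣≡1 {suc n} zero) (maximum ⁅ zero ⁆ singleton-clique)
  where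
  singleton-clique : IsClique K ⁅ zero ⁆
  singleton-clique u v u∈ v∈ u≢v =
    contradiction (trans (x∈⁅y⁆⇒x≡y zero u∈) (sym (x∈⁅y⁆⇒x≡y zero v∈))) u≢v

module Insertion {n : ℕ} (G : Graph n) (ω : ℕ) where

  processed : ℕ → Predᵇ n
  processed k y = does (toℕ y <? k)

  neighbours : ℕ → Fin n → Predᵇ n
  neighbours k x y = processed k y ∧ adj G y x

  extendK : Orient n → Fin n → Predᵇ n → Orient n
  extendK K x g u v =
    if does (u ≟ x) then not (g v) else if does (v ≟ x) then g u else K u v

  reachesX : Relᵇ n → Predᵇ n → Fin n → Predᵇ n → Predᵇ n
  reachesX R N x g y = does (y ≟ x) ∨ does (search (λ a → N a ∧ g a ∧ R y a))

  reachedFromX : Relᵇ n → Predᵇ n → Fin n → Predᵇ n → Predᵇ n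
  reachedFromX R N x g z = does (z ≟ x) ∨ does (search (λ b → N b ∧ not (g b) ∧ R b z))

  -- The new pairs are y ⇝ x ⇝ z, detected through the neighbours of x on either side.
  extendR : ℕ → Fin n → Relᵇ n → Predᵇ n → Relᵇ n
  extendR k x R g y z =
    (processed k y ∧ processed k z ∧ R y z) ∨ (reachesX R N x g y ∧ reachedFromX R N x g z)
    where N = neighbours k x

  vertexAt : ∀ k r → suc r + k ≡ n → Fin n
  vertexAt k r r+k≡n = fromℕ< (subst (k <_) r+k≡n (m<n+m k z<s))

  insertAll : (k r : ℕ) → r + k ≡ n → Orient n → Relᵇ n → Probing n (Orient n)
  insertAll k zero    _   K R = return K
  insertAll k (suc r) r+k≡n K R =
    let x = vertexAt k r r+k≡n in
    Locate.locate R x ω n (neighbours k x) (neighbours k x) >>= λ g →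
      insertAll (suc k) r (trans (+-suc r k) r+k≡n) (extendK K x g) (extendR k x R g)

  record Knowledge (d : Orient n) (k : ℕ) (K : Orient n) (R : Relᵇ n) : Set where
    field
      K-correct    : ∀ u v → processed k u ≡ true → processed k v ≡ true →
                     adj G u v ≡ true → K u v ≡ d u v
      R-reflexive  : ∀ y → processed k y ≡ true → R y y ≡ true
      R-transitive : ∀ a b c → processed k a ≡ true → processed k b ≡ true → processed k c ≡ true →
                     R a b ≡ true → R b c ≡ true → R a c ≡ true
      R-sound      : ∀ y z → processed k y ≡ true → processed k z ≡ true →
                     R y z ≡ true → Reach G d y z
      R-complete   : ∀ y z → processed k y ≡ true → processed k z ≡ true →
                     adj G y z ≡ true → d y z ≡ true → R y z ≡ true

  knowledge-zero : ∀ d → Knowledge d 0 (λ _ _ → false) (λ _ _ → false)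
  knowledge-zero d = record
    { K-correct = λ u _ p → contradiction p (not-¬ (nothing-processed u))
    ; R-reflexive = λ y p → contradiction p (not-¬ (nothing-processed y))
    ; R-transitive = λ a _ _ p → contradiction p (not-¬ (nothing-processed a))
    ; R-sound = λ y _ p → contradiction p (not-¬ (nothing-processed y))
    ; R-complete = λ y _ p → contradiction p (not-¬ (nothing-processed y))
    }
    where
    nothing-processed : ∀ y → processed 0 y ≡ false
    nothing-processed y = dec-false (toℕ y <? 0) λ ()

  module Extend {d : Orient n} (orientation : IsOrientation G d)
    {k : ℕ} {x : Fin n} (x≡k : toℕ x ≡ k) {K : Orient n} {R : Relᵇ n} (know : Knowledge d k K R)
    (g : Predᵇ n) (g-correct : ∀ z → neighbours k x z ≡ true → g z ≡ d z x)
    where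

    open Knowledge know
    N = neighbours k x
    A = reachesX R N x g
    B = reachedFromX R N x g

    processed-suc : ∀ y → processed (suc k) y ≡ true → processed k y ≡ true ⊎ y ≡ x
    processed-suc y p with m<1+n⇒m<n∨m≡n (does-true⁻ (toℕ y <? suc k) p)
    ... | inj₁ y<k = inj₁ (dec-true (toℕ y <? k) y<k)
    ... | inj₂ y≡k = inj₂ (toℕ-injective (trans y≡k (sym x≡k)))

    processed⇒≢x : ∀ {y} → processed k y ≡ true → y ≢ x
    processed⇒≢x {y} p refl = <-irrefl x≡k (does-true⁻ (toℕ y <? k) p)

    ≢x : ∀ {y} → y ≢ x → does (y ≟ x) ≡ false
    ≢x {y} y≢x = dec-false (y ≟ x) y≢x

    ≡x : does (x ≟ x) ≡ true
    ≡x = dec-true (x ≟ x) refl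

    neighbour : ∀ {y} → processed k y ≡ true → adj G y x ≡ true → N y ≡ true
    neighbour = ∧-true⁺

    A-x : A x ≡ true
    A-x = ∨-true⁺ˡ _ ≡x

    B-x : B x ≡ true
    B-x = ∨-true⁺ˡ _ ≡x

    A⁺ : ∀ y a → N a ≡ true → g a ≡ true → R y a ≡ true → A y ≡ true
    A⁺ y a Na ga Rya = ∨-true⁺ʳ _ (dec-true (search _) (a , ∧-true⁺ Na (∧-true⁺ ga Rya)))

    B⁺ : ∀ z b → N b ≡ true → g b ≡ false → R b z ≡ true → B z ≡ true
    B⁺ z b Nb gb Rbz = ∨-true⁺ʳ _ (dec-true (search _) (b , ∧-true⁺ Nb (∧-true⁺ (cong not gb) Rbz)))

    A⁻ : ∀ y → y ≢ x → A y ≡ true → ∃ λ a → N a ≡ true × g a ≡ true × R y a ≡ true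
    A⁻ y y≢x Ay with ∨-true⁻ {does (y ≟ x)} Ay
    ... | inj₁ y≡x  = contradiction (does-true⁻ (y ≟ x) y≡x) y≢x
    ... | inj₂ some =
      let (a , e) = does-true⁻ (search (λ a → N a ∧ g a ∧ R y a)) some
          (Na , ga∧Rya) = ∧-true⁻ e
          (ga , Rya) = ∧-true⁻ ga∧Rya
      in a , Na , ga , Rya

    B⁻ : ∀ z → z ≢ x → B z ≡ true → ∃ λ b → N b ≡ true × g b ≡ false × R b z ≡ true
    B⁻ z z≢x Bz with ∨-true⁻ {does (z ≟ x)} Bz
    ... | inj₁ z≡x  = contradiction (does-true⁻ (z ≟ x) z≡x) z≢x
    ... | inj₂ some =
      let (b , e) = does-true⁻ (search (λ b → N b ∧ not (g b) ∧ R b z)) some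
          (Nb , ¬gb∧Rbz) = ∧-true⁻ e
          (¬gb , Rbz) = ∧-true⁻ ¬gb∧Rbz
      in b , Nb , not-true⁻ ¬gb , Rbz

    N-processed : ∀ {y} → N y ≡ true → processed k y ≡ true
    N-processed = proj₁ ∘ ∧-true⁻

    N-adj : ∀ {y} → N y ≡ true → adj G y x ≡ true
    N-adj {y} = proj₂ ∘ ∧-true⁻ {processed k y}

    A-closed : ∀ a b → processed k a ≡ true → processed k b ≡ true →
               R a b ≡ true → A b ≡ true → A a ≡ true
    A-closed a b pa pb Rab Ab =
      let (a′ , Na′ , ga′ , Rba′) = A⁻ b (processed⇒≢x pb) Ab
      in A⁺ a a′ Na′ ga′ (R-transitive a b a′ pa pb (N-processed Na′) Rab Rba′)

    B-closed : ∀ b c → processed k b ≡ true → processed k c ≡ true →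
               R b c ≡ true → B b ≡ true → B c ≡ true
    B-closed b c pb pc Rbc Bb =
      let (b′ , Nb′ , gb′ , Rb′b) = B⁻ b (processed⇒≢x pb) Bb
      in B⁺ c b′ Nb′ gb′ (R-transitive b′ b c (N-processed Nb′) pb pc Rb′b Rbc)

    A-reach : ∀ y → processed (suc k) y ≡ true → A y ≡ true → Reach G d y x
    A-reach y p Ay with processed-suc y p
    ... | inj₂ refl = ε
    ... | inj₁ py =
      let (a , Na , ga , Rya) = A⁻ y (processed⇒≢x py) Ay
      in R-sound y a py (N-processed Na) Rya ◅◅ ((N-adj Na , trans (sym (g-correct a Na)) ga) ◅ ε)

    B-reach : ∀ z → processed (suc k) z ≡ true → B z ≡ true → Reach G d x z
    B-reach z p Bz with processed-suc z p
    ... | inj₂ refl = ε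
    ... | inj₁ pz =
      let (b , Nb , gb , Rbz) = B⁻ z (processed⇒≢x pz) Bz
          x→b = trans (symm G x b) (N-adj Nb) ,
                trans (orientation b x (N-adj Nb)) (cong not (trans (sym (g-correct b Nb)) gb))
      in x→b ◅ R-sound b z (N-processed Nb) pz Rbz

    R′ = extendR k x R g
    K′ = extendK K x g

    R′⁻ : ∀ {y z} → R′ y z ≡ true →
          (processed k y ≡ true × processed k z ≡ true × R y z ≡ true) ⊎ (A y ≡ true × B z ≡ true)
    R′⁻ {y} {z} e with ∨-true⁻ {processed k y ∧ processed k z ∧ R y z} e
    ... | inj₁ old = inj₁ (let (py , rest) = ∧-true⁻ old ; (pz , Ryz) = ∧-true⁻ rest in py , pz , Ryz)
    ... | inj₂ new = inj₂ (∧-true⁻ new)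

    old⁺ : ∀ {y z} → processed k y ≡ true → processed k z ≡ true → R y z ≡ true → R′ y z ≡ true
    old⁺ py pz Ryz = ∨-true⁺ˡ _ (∧-true⁺ py (∧-true⁺ pz Ryz))

    new⁺ : ∀ {y z} → A y ≡ true → B z ≡ true → R′ y z ≡ true
    new⁺ {y} {z} Ay Bz = ∨-true⁺ʳ (processed k y ∧ processed k z ∧ R y z) (∧-true⁺ Ay Bz)

    knowledge-suc : Knowledge d (suc k) K′ R′
    knowledge-suc = record
      { K-correct    = K′-correct
      ; R-reflexive  = R′-reflexive
      ; R-transitive = R′-transitive
      ; R-sound      = R′-sound
      ; R-complete   = R′-complete
      }
      where
      K′-correct : ∀ u v → processed (suc k) u ≡ true → processed (suc k) v ≡ true →
                   adj G u v ≡ true → K′ u v ≡ d u v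
      K′-correct u v pu pv uv with processed-suc u pu | processed-suc v pv
      ... | inj₂ refl | inj₂ refl = contradiction uv (not-¬ (irrefl G x))
      ... | inj₂ refl | inj₁ pv′ rewrite ≡x =
        let vx = trans (symm G v x) uv
        in trans (cong not (g-correct v (neighbour pv′ vx))) (sym (orientation v x vx))
      ... | inj₁ pu′ | inj₂ refl rewrite ≢x (processed⇒≢x pu′) | ≡x = g-correct u (neighbour pu′ uv)
      ... | inj₁ pu′ | inj₁ pv′ rewrite ≢x (processed⇒≢x pu′) | ≢x (processed⇒≢x pv′) =
        K-correct u v pu′ pv′ uv

      R′-reflexive : ∀ y → processed (suc k) y ≡ true → R′ y y ≡ true
      R′-reflexive y p with processed-suc y p
      ... | inj₁ py   = old⁺ py py (R-reflexive y py)
      ... | inj₂ refl = new⁺ A-x B-x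

      R′-transitive : ∀ a b c → processed (suc k) a ≡ true → processed (suc k) b ≡ true →
                      processed (suc k) c ≡ true → R′ a b ≡ true → R′ b c ≡ true → R′ a c ≡ true
      R′-transitive a b c _ _ _ R′ab R′bc with R′⁻ R′ab | R′⁻ R′bc
      ... | inj₁ (pa , pb , Rab) | inj₁ (_ , pc , Rbc) = old⁺ pa pc (R-transitive a b c pa pb pc Rab Rbc)
      ... | inj₁ (pa , pb , Rab) | inj₂ (Ab , Bc)      = new⁺ (A-closed a b pa pb Rab Ab) Bc
      ... | inj₂ (Aa , Bb)      | inj₁ (pb , pc , Rbc) = new⁺ Aa (B-closed b c pb pc Rbc Bb)
      ... | inj₂ (Aa , _)       | inj₂ (_ , Bc)        = new⁺ Aa Bc

      R′-sound : ∀ y z → processed (suc k) y ≡ true → processed (suc k) z ≡ true →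
                 R′ y z ≡ true → Reach G d y z
      R′-sound y z py pz R′yz with R′⁻ R′yz
      ... | inj₁ (py′ , pz′ , Ryz) = R-sound y z py′ pz′ Ryz
      ... | inj₂ (Ay , Bz)         = A-reach y py Ay ◅◅ B-reach z pz Bz

      R′-complete : ∀ y z → processed (suc k) y ≡ true → processed (suc k) z ≡ true →
                    adj G y z ≡ true → d y z ≡ true → R′ y z ≡ true
      R′-complete y z py pz yz y→z with processed-suc y py | processed-suc z pz
      ... | inj₂ refl | inj₂ refl = contradiction yz (not-¬ (irrefl G x))
      ... | inj₂ refl | inj₁ pz′ =
        let zx = trans (symm G z x) yz
            gz = trans (g-correct z (neighbour pz′ zx)) (trans (orientation x z yz) (cong not y→z))
        in new⁺ A-x (B⁺ z z (neighbour pz′ zx) gz (R-reflexive z pz′))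
      ... | inj₁ py′ | inj₂ refl =
        let Ny = neighbour py′ yz
        in new⁺ (A⁺ y y Ny (trans (g-correct y Ny) y→z) (R-reflexive y py′)) B-x
      ... | inj₁ py′ | inj₁ pz′ = old⁺ py′ pz′ (R-complete y z py′ pz′ yz y→z)

module InsertionCorrect {n : ℕ} {G : Graph n} {ω : ℕ} (clique : IsCliqueNumber (complement G) ω)
  {d : Orient n} (orientation : IsOrientation G d) (acyclic : IsAcyclic G d) where

  open Insertion G ω

  module _ {k K R} (know : Knowledge d k K R) where
    open Knowledge know

    adjacent⇒comparable : ∀ u v → processed k u ≡ true → processed k v ≡ true → adj G u v ≡ true →
                          R u v ≡ true ⊎ R v u ≡ true
    adjacent⇒comparable u v pu pv uv with d u v in u→v
    ... | true  = inj₁ (R-complete u v pu pv uv u→v)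
    ... | false =
      inj₂ (R-complete v u pv pu (trans (symm G v u) uv) (trans (orientation u v uv) (cong not u→v)))

    knowledge⇒poset : ∀ x → IsPosetOfWidth R (neighbours k x) ω
    knowledge⇒poset x = record
      { reflexive     = λ a Na → R-reflexive a (p Na)
      ; transitive    = λ a b c Na Nb Nc → R-transitive a b c (p Na) (p Nb) (p Nc)
      ; antisymmetric = λ a b Na Nb Rab Rba →
          reach-antisym {G = G} acyclic (R-sound a b (p Na) (p Nb) Rab) (R-sound b a (p Nb) (p Na) Rba)
      ; width         = λ P P⊆N anti → independent≤clique-number G clique P (independent P P⊆N anti)
      }
      where
      p : ∀ {y} → neighbours k x y ≡ true → processed k y ≡ true
      p = proj₁ ∘ ∧-true⁻
      independent : ∀ P → P ⊆ᵇ neighbours k x → IsAntichain R P → IsIndependent G P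
      independent P P⊆N anti u v Pu Pv u≢v = ¬-not λ uv →
        [ (λ Ruv → not-¬ Ruv (anti u v Pu Pv u≢v))
        , (λ Rvu → not-¬ Rvu (anti v u Pv Pu (u≢v ∘ sym))) ]′
        (adjacent⇒comparable u v (p (P⊆N u Pu)) (p (P⊆N v Pv)) uv)

  module Step {k r} (r+k≡n : suc r + k ≡ n) {K R} (know : Knowledge d k K R) where
    open Knowledge know

    x = vertexAt k r r+k≡n
    N = neighbours k x
    located = Locate.locate R x ω n N N
    g = run located d

    continue : Predᵇ n → Probing n (Orient n)
    continue h = insertAll (suc k) r (trans (+-suc r k) r+k≡n) (extendK K x h) (extendR k x R h)

    open LocateCorrect {G = G} orientation acyclic {R = R} {x = x} {ω = ω} {T = N}
      (λ y → proj₂ ∘ ∧-true⁻ {processed k y})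
      (knowledge⇒poset know x)
      (λ y z Ny Nz → R-sound y z (proj₁ (∧-true⁻ Ny)) (proj₁ (∧-true⁻ Nz)))
      public

    g-correct : ∀ z → N z ≡ true → g z ≡ d z x
    g-correct = locate-correct n N N (λ _ e → e) (count≤n N) (λ z Nz ¬Nz → contradiction Nz (not-¬ ¬Nz))

    knowledge-next : Knowledge d (suc k) (extendK K x g) (extendR k x R g)
    knowledge-next = Extend.knowledge-suc orientation (toℕ-fromℕ< _) know g g-correct

  insertAll-correct : ∀ r k (r+k≡n : r + k ≡ n) {K R} → Knowledge d k K R →
                      ∀ u v → adj G u v ≡ true → run (insertAll k r r+k≡n K R) d u v ≡ d u v
  insertAll-correct zero k r+k≡n know u v = Knowledge.K-correct know u v (all-processed u) (all-processed v)
    where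
    all-processed : ∀ y → processed k y ≡ true
    all-processed y = dec-true (toℕ y <? k) (subst (toℕ y <_) (sym r+k≡n) (toℕ<n y))
  insertAll-correct (suc r) k r+k≡n know u v uv =
    trans (cong (λ o → o u v) (run->>= located continue d))
          (insertAll-correct r (suc k) _ knowledge-next u v uv)
    where open Step {k} {r} r+k≡n know

  insertAll-probesEdges : ∀ r k (r+k≡n : r + k ≡ n) {K R} → Knowledge d k K R →
                          ProbesEdges G (insertAll k r r+k≡n K R) d
  insertAll-probesEdges zero    k r+k≡n know = tt
  insertAll-probesEdges (suc r) k r+k≡n know =
    probesEdges->>= G located continue d (locate-probesEdges n N N (λ _ e → e))
      (insertAll-probesEdges r (suc k) _ knowledge-next)
    where open Step {k} {r} r+k≡n know

  insertAll-cost : ∀ B → n < 2 ^ B → ∀ r k (r+k≡n : r + k ≡ n) {K R} → Knowledge d k K R →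
                   cost (insertAll k r r+k≡n K R) d ≤ r * (suc (ω + ω) * B)
  insertAll-cost B n<2^B zero    k r+k≡n know = z≤n
  insertAll-cost B n<2^B (suc r) k r+k≡n {K} {R} know = begin
    cost (insertAll k (suc r) r+k≡n K R) d
      ≡⟨ cost->>= located continue d ⟩
    cost located d + cost (continue g) d
      ≤⟨ +-mono-≤ (locate-cost B n N N (λ _ e → e) (count≤n N) (≤-<-trans (count≤n N) n<2^B))
                  (insertAll-cost B n<2^B r (suc k) _ knowledge-next) ⟩
    suc (ω + ω) * B + r * (suc (ω + ω) * B) ∎
    where
    open Step {k} {r} r+k≡n know
    open ≤-Reasoning

n<2^[1+⌊log₂n⌋] : ∀ n → n < 2 ^ suc ⌊log₂ n ⌋
n<2^[1+⌊log₂n⌋] n = ≰⇒> λ 2^[1+⌊log₂n⌋]≤n →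
  n≮n ⌊log₂ n ⌋ (subst (_≤ ⌊log₂ n ⌋) (⌊log₂[2^n]⌋≡n (suc ⌊log₂ n ⌋))
                       (⌊log₂⌋-mono-≤ 2^[1+⌊log₂n⌋]≤n))

⌊log₂⌋-pos : 2 ≤ n → 1 ≤ ⌊log₂ n ⌋
⌊log₂⌋-pos {n} 2≤n = subst (_≤ ⌊log₂ n ⌋) (⌊log₂[2^n]⌋≡n 1) (⌊log₂⌋-mono-≤ 2≤n)

probe-budget : ∀ n {ω L} → 1 ≤ ω → 1 ≤ L → n * (suc (ω + ω) * suc L) ≤ 6 * (n * (ω * L))
probe-budget n {ω} {L} 1≤ω 1≤L = begin
  n * (suc (ω + ω) * suc L)       ≤⟨ *-monoʳ-≤ n (*-mono-≤ (+-monoˡ-≤ (ω + ω) 1≤ω) (+-monoˡ-≤ L 1≤L)) ⟩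
  n * ((ω + (ω + ω)) * (L + L))   ≡⟨ six-fold n ω L ⟩
  6 * (n * (ω * L))               ∎
  where
  open ≤-Reasoning
  six-fold : ∀ n ω L → n * ((ω + (ω + ω)) * (L + L)) ≡ 6 * (n * (ω * L))
  six-fold = solve-∀

insertionAlg : Graph n → ℕ → Alg n
insertionAlg {n} G ω = toAlg (Insertion.insertAll G ω 0 n (+-identityʳ n) (λ _ _ → false) (λ _ _ → false))

insertionAlg-correct : ∀ (G : Graph n) {ω} → IsCliqueNumber (complement G) ω → ∀ B → n < 2 ^ B →
                       ∀ d → IsAcyclicOrientation G d →
                       ValidRun G (insertionAlg G ω) d × CorrectRun G (insertionAlg G ω) d ×
                       probes (insertionAlg G ω) d ≤ n * (suc (ω + ω) * B)
insertionAlg-correct {n} G {ω} clique B n<2^B d (orientation , acyclic) =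
  validRun-toAlg G algorithm d (insertAll-probesEdges n 0 _ start) ,
  (λ u v uv → trans (cong (λ o → o u v) (output-toAlg algorithm d)) (insertAll-correct n 0 _ start u v uv)) ,
  subst (_≤ _) (sym (probes-toAlg algorithm d)) (insertAll-cost B n<2^B n 0 _ start)
  where
  open Insertion G ω
  open InsertionCorrect clique orientation acyclic
  algorithm = insertAll 0 n (+-identityʳ n) (λ _ _ → false) (λ _ _ → false)
  start = knowledge-zero d

mainTheorem2 : Σ ℕ λ C → ∀ (n : ℕ) → 2 ≤ n → (G : Graph n) → (ω : ℕ) →
    IsCliqueNumber (complement G) ω →
    Σ (Alg n) λ A → ∀ (d : Orient n) → IsAcyclicOrientation G d →
      ValidRun G A d × CorrectRun G A d × probes A d ≤ C * (n * (ω * ⌊log₂ n ⌋))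
mainTheorem2 = 6 , λ where
  (suc m) 2≤n G ω clique → insertionAlg G ω , λ d acyclic-orientation →
    let n = suc m
        (valid , correct , few) =
          insertionAlg-correct G clique (suc ⌊log₂ n ⌋) (n<2^[1+⌊log₂n⌋] n) d acyclic-orientation
    in valid , correct ,
       ≤-trans few (probe-budget n (clique-number-pos (complement G) clique) (⌊log₂⌋-pos 2≤n))
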